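{- Let $G,H$ be finite digraphs. In the Seurat game $\mathbf{G}^2(G,H)$ (colours red and blue), if $\forall$ colours a subset $X$ of $G$ red and $\exists$ responds by colouring a subset $Y$ of $H$ red, then, unless the tally-spectrum of $Y$ in $H$ equals the tally-spectrum of $X$ in $G$, player $\forall$ has a winning strategy from the resulting position (i.e. $\exists$ must respond with such a $Y$).
   Context: Digraphs: finite vertex set $V$ with edges $E\subseteq V\times V$ (loops allowed). For a vertex $v$ and $Y\subseteq V$: $\tau_Y(v)=(|E\cap(Y\times\{v\})|,|E\cap(\{v\}\times Y)|)$. The tally-sequence $\vec\tau(v)=(t^v_0,t^v_1,\ldots)$ is defined recursively for all vertices simultaneously: $t^v_0=\tau_V(v)$, and $t^v_{k+1}=\tau_{X^v_k}(v)$ where $X^v_k=\{u\in V:(t^u_0,\ldots,t^u_k)=(t^v_0,\ldots,t^v_k)\}$. The tally-spectrum of a set $X$ in $G$ is the multiset of tally-sequences (computed in all of $G$) of the vertices in $X$. Seurat game $\mathbf{G}^k(G,H)$: two players $\forall,\exists$, a set $\mathbf{Col}$ of $k$ colours. A position is a pair of functions $g:\mathbf{Col}\to\wp(G)$, $h:\mathbf{Col}\to\wp(H)$, initially all empty. In each of $\omega$ rounds $\forall$ chooses a colour $c$, one of the graphs and a subset of its vertices; $\exists$ then chooses a subset of the other graph; $c$ is then assigned these two sets (erasing its previous use). The palette of a vertex is the set of colours whose set contains it; $P^G$ is the set of vertices of $G$ with palette exactly $P$. $\forall$ wins in round $n$ if at its beginning (C1) some palette $P$ has $P^G$ empty and $P^H$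 nonempty or vice versa, or (C2) there are palettes $P_1,P_2$ with an edge from $P_1^G$ to $P_2^G$ but none from $P_1^H$ to $P_2^H$, or vice versa. $\forall$ has a winning strategy from a position if he can guarantee a win in finitely many further rounds. -}

module Defs where

open import Data.Nat using (ℕ; zero; suc; _+_)
open import Data.Bool using (Bool; true; false; if_then_else_; _∧_)
open import Data.Fin using (Fin; zero; suc)
import Data.Fin as Fin
open import Data.Product using (Σ; ∃; _×_; _,_; proj₁)
open import Data.Product.Properties as ×P using ()
open import Data.Sum using (_⊎_)
open import Data.Vec using (Vec; _∷_; []; head)
import Data.Vec.Properties as VecP
import Data.Nat as Nat
open import Function using (_∘_)
open import Function.Bundles using (_↔_; Inverse)
open import Relation.Nullary using (¬_; does; Dec)
open import Relation.Binary.PropositionalEquality using (_≡_)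

record Digraph : Set where
  field
    n : ℕ
    E : Fin n → Fin n → Bool
open Digraph public

V : Digraph → Set
V G = Fin (n G)

Sub : Digraph → Set
Sub G = V G → Bool

count : ∀ {m} → (Fin m → Bool) → ℕ
count {zero}  p = 0
count {suc m} p = (if p zero then 1 else 0) + count (p ∘ suc)

τ : (G : Digraph) → Sub G → V G → ℕ × ℕ
τ G Y v = count (λ u → Y u ∧ E G u v) , count (λ u → Y u ∧ E G v u)

_≟P_ : ∀ {m} (a b : Vec (ℕ × ℕ) m) → Dec (a ≡ b)
_≟P_ = VecP.≡-dec (×P.≡-dec Nat._≟_ Nat._≟_)

-- prefix G k v = (t^v_k , t^v_{k-1} , … , t^v_0)  (the prefix, stored reversed)
prefix : (G : Digraph) → (k : ℕ) → V G → Vec (ℕ × ℕ) (suc k)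
prefix G zero    v = τ G (λ _ → true) v ∷ []
prefix G (suc k) v =
  τ G (λ u → does (prefix G k u ≟P prefix G k v)) v ∷ prefix G k v

tallySeq : (G : Digraph) → V G → ℕ → ℕ × ℕ
tallySeq G v k = head (prefix G k v)

-- the tally-spectrum of X in G equals that of Y in H (equality of multisets of
-- tally-sequences): a bijection X ≅ Y preserving tally-sequences.
Elem : (G : Digraph) → Sub G → Set
Elem G X = Σ (V G) (λ v → X v ≡ true)

SameSpectrum : (G : Digraph) → Sub G → (H : Digraph) → Sub H → Set
SameSpectrum G X H Y =
  Σ (Elem G X ↔ Elem H Y) λ f →
    ∀ (a : Elem G X) (k : ℕ) →
      tallySeq G (proj₁ a) k ≡ tallySeq H (proj₁ (Inverse.to f a)) k

Palette : ℕ → Set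
Palette c = Fin c → Bool

HasPal : ∀ {c} (G : Digraph) → (Fin c → Sub G) → Palette c → Set
HasPal G g P = ∃ λ (v : V G) → ∀ col → g col v ≡ P col

EdgePal : ∀ {c} (G : Digraph) → (Fin c → Sub G) → Palette c → Palette c → Set
EdgePal G g P₁ P₂ = ∃ λ (u : V G) → ∃ λ (v : V G) →
  (∀ col → g col u ≡ P₁ col) × (∀ col → g col v ≡ P₂ col) × (E G u v ≡ true)

C1 : ∀ {c} (G H : Digraph) → (Fin c → Sub G) → (Fin c → Sub H) → Set
C1 G H g h = ∃ λ P →
  (HasPal G g P × ¬ HasPal H h P) ⊎ (¬ HasPal G g P × HasPal H h P)

C2 : ∀ {c} (G H : Digraph) → (Fin c → Sub G) → (Fin c → Sub H) → Set
C2 G H g h = ∃ λ P₁ → ∃ λ P₂ →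
  (EdgePal G g P₁ P₂ × ¬ EdgePal H h P₁ P₂) ⊎ (¬ EdgePal G g P₁ P₂ × EdgePal H h P₁ P₂)

assign : ∀ {c} {A : Set} → (Fin c → A) → Fin c → A → (Fin c → A)
assign g col S col′ = if does (col′ Fin.≟ col) then S else g col′

-- ∀ has a winning strategy from position (g , h): he can force a win
-- (condition C1 or C2 at the beginning of a round) in finitely many rounds.
data ForallWins {c} (G H : Digraph) : (Fin c → Sub G) → (Fin c → Sub H) → Set where
  won   : ∀ {g h} → C1 G H g h ⊎ C2 G H g h → ForallWins G H g h
  moveG : ∀ {g h} (col : Fin c) (S : Sub G) →
          (∀ (T : Sub H) → ForallWins G H (assign g col S) (assign h col T)) →
          ForallWins G H g h
  moveH : ∀ {g h} (col : Fin c) (T : Sub H) →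
          (∀ (S : Sub G) → ForallWins G H (assign g col S) (assign h col T)) →
          ForallWins G H g h

-- two colours: red = zero, blue = suc zero.  The position where red is X (in G)
-- and blue is still unused (empty).
redOnly : (G : Digraph) → Sub G → Fin 2 → Sub G
redOnly G X zero    = X
redOnly G X (suc _) = λ _ → false

-- By induction on k, ∃ loses unless
--   (a) whenever ∀ paints a colour as a level-k class of one graph, she paints the same
--       level-k class in the other, and
--   (b) every level-k class meets a colour in equally many vertices in both graphs.
-- A size mismatch of a colour is punished by repeatedly painting the spare colour with the
-- larger set minus one vertex. Given (a) and (b) at level k, a failure of (a) at level k + 1
-- is narrowed down, by painting the spare colour first with the level-k class and then with
-- a single vertex w where the copy fails, to a partner z of w whose tally with respect to
-- that class differs from w's; i.e. z and w have different numbers of in- or out-neighbours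
-- in the class, which (b) punishes after ∀ paints the neighbourhood of z. Finally the
-- refinement by tallies stabilises within n² steps in a graph with n vertices, so once the
-- red sets meet every class of level n_G² + n_H² + 1 equally, matching vertices class by
-- class gives a bijection preserving whole tally sequences.

module Submission where

open import Defs
open import Axiom.UniquenessOfIdentityProofs using (module Decidable⇒UIP)
open import Data.Bool using (Bool; true; false; if_then_else_; _∧_; not) renaming (_≟_ to _≟ᵇ_)
open import Data.Bool.Properties using (∧-conicalˡ; ∧-conicalʳ; ∧-identityʳ; ∧-zeroʳ; ∧-assoc; ∧-comm)
open import Data.Empty using (⊥; ⊥-elim)
open import Data.Fin using (Fin; zero; suc; combine; remQuot)
import Data.Fin as Fin
open import Data.Fin.Properties using (any?; remQuot-combine)
open import Data.Nat using (ℕ; zero; suc; _+_; _*_; _≤_; _<_; _≤′_; ≤′-refl; ≤′-step; z≤n; s≤s; _≟_; _≤?_)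
open import Data.Nat.Properties
open import Data.Product using (Σ; ∃; _×_; _,_; proj₁; proj₂; uncurry)
open import Data.Sum using (_⊎_; inj₁; inj₂)
open import Data.Sum.Function.Propositional using (_⊎-↔_)
open import Data.Unit using (⊤; tt)
open import Data.Vec using (Vec; []; _∷_; head)
open import Data.Vec.Properties using (∷-injective)
open import Function using (_∘_; id)
open import Function.Bundles using (_↔_; Inverse; mk↔ₛ′; mk⇔)
open import Function.Properties.Inverse using (↔-refl; ↔-trans; ↔-sym)
open import Relation.Binary.Definitions using (DecidableEquality; tri<; tri≈; tri>)
open import Relation.Binary.PropositionalEquality
open import Relation.Nullary using (¬_; ¬?; Dec; yes; no; does)
open import Relation.Nullary.Decidable using (dec-true; dec-false; does-⇔; decidable-stable)

private variable
  m m′ c k : ℕ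
  G H : Digraph
  A : Set
  p q : Fin m → Bool

-- Finite sets as Boolean predicates on Fin m

true⇒≢false : ∀ {b} → b ≡ true → b ≢ false
true⇒≢false refl ()

does⇒ : (a? : Dec A) → does a? ≡ true → A
does⇒ (yes a) _ = a

_⊆_ : (p q : Fin m → Bool) → Set
p ⊆ q = ∀ i → p i ≡ true → q i ≡ true

_≐_ : (p q : Fin m → Bool) → Set
p ≐ q = ∀ i → p i ≡ q i

_∩_ : (p q : Fin m → Bool) → Fin m → Bool
(p ∩ q) i = p i ∧ q i

｛_｝ : Fin m → Fin m → Bool
｛ j ｝ i = does (i Fin.≟ j)

_∖｛_｝ : (Fin m → Bool) → Fin m → Fin m → Bool
p ∖｛ j ｝ = p ∩ (not ∘ ｛ j ｝)

∩-⊆ˡ : (p q : Fin m → Bool) → (p ∩ q) ⊆ p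
∩-⊆ˡ p q i = ∧-conicalˡ (p i) (q i)

∩-⊆ʳ : (p q : Fin m → Bool) → (p ∩ q) ⊆ q
∩-⊆ʳ p q i = ∧-conicalʳ (p i) (q i)

⊆-∩ : ∀ {r : Fin m → Bool} → r ⊆ p → r ⊆ q → r ⊆ (p ∩ q)
⊆-∩ r⊆p r⊆q i ri = cong₂ _∧_ (r⊆p i ri) (r⊆q i ri)

⊆-antisym : p ⊆ q → q ⊆ p → p ≐ q
⊆-antisym {p = p} {q} p⊆q q⊆p i with p i in pi | q i in qi
... | true  | true  = refl
... | false | false = refl
... | true  | false = ⊥-elim (true⇒≢false (p⊆q i pi) qi)
... | false | true  = ⊥-elim (true⇒≢false (q⊆p i qi) pi)

data Inclusion (p q : Fin m → Bool) : Set where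
  included : p ⊆ q → Inclusion p q
  escapes  : ∀ i → p i ≡ true → q i ≡ false → Inclusion p q

inclusion? : (p q : Fin m → Bool) → Inclusion p q
inclusion? {zero} p q = included λ ()
inclusion? {suc m} p q with p zero in p₀ | q zero in q₀ | inclusion? (p ∘ suc) (q ∘ suc)
... | true  | false | _               = escapes zero p₀ q₀
... | _     | _     | escapes i pi qi = escapes (suc i) pi qi
... | true  | true  | included p⊆q    = included λ { zero _ → q₀ ; (suc i) → p⊆q i }
... | false | _     | included p⊆q    =
  included λ { zero p₀≡t → ⊥-elim (true⇒≢false p₀≡t p₀) ; (suc i) → p⊆q i }

indicator-mono : ∀ {a b} → (a ≡ true → b ≡ true) → (if a then 1 else 0) ≤ (if b then 1 else 0)
indicator-mono {false} _ = z≤n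
indicator-mono {true} a⇒b rewrite a⇒b refl = ≤-refl

count-cong : p ≐ q → count p ≡ count q
count-cong {zero} _ = refl
count-cong {suc m} p≐q = cong₂ _+_ (cong (λ b → if b then 1 else 0) (p≐q zero)) (count-cong (p≐q ∘ suc))

count-mono : p ⊆ q → count p ≤ count q
count-mono {zero} _ = z≤n
count-mono {suc m} p⊆q = +-mono-≤ (indicator-mono (p⊆q zero)) (count-mono (p⊆q ∘ suc))

count-mono-< : p ⊆ q → (j : Fin m) → q j ≡ true → p j ≡ false → count p < count q
count-mono-< {suc m} p⊆q zero qj pj rewrite qj | pj = s≤s (count-mono (p⊆q ∘ suc))
count-mono-< {suc m} p⊆q (suc j) qj pj =
  +-mono-≤-< (indicator-mono (p⊆q zero)) (count-mono-< (p⊆q ∘ suc) j qj pj)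

count-≤ : (p : Fin m → Bool) → count p ≤ m
count-≤ {zero} p = z≤n
count-≤ {suc m} p = +-mono-≤ (indicator-mono {b = true} λ _ → refl) (count-≤ (p ∘ suc))

count-empty : count {m} (λ _ → false) ≡ 0
count-empty {zero} = refl
count-empty {suc m} = count-empty {m}

count-pos : (p : Fin m → Bool) {j : Fin m} → p j ≡ true → 0 < count p
count-pos {m} p {j} pj = subst (_< count p) (count-empty {m}) (count-mono-< (λ _ ()) j pj refl)

count-pos⇒∃ : (p : Fin m → Bool) → 0 < count p → ∃ λ j → p j ≡ true
count-pos⇒∃ {suc m} p 0<c with p zero in p₀
... | true  = zero , p₀
... | false = let j , pj = count-pos⇒∃ (p ∘ suc) 0<c in suc j , pj

count-zero : (p : Fin m → Bool) → count p ≡ 0 → ∀ j → p j ≡ false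
count-zero p c≡0 j with p j in pj
... | false = refl
... | true  = ⊥-elim (<-irrefl (sym c≡0) (count-pos p pj))

count-remove : (p : Fin m → Bool) {j : Fin m} → p j ≡ true → count p ≡ suc (count (p ∖｛ j ｝))
count-remove {suc m} p {zero} pj rewrite pj =
  cong suc (count-cong λ i → sym (∧-identityʳ (p (suc i))))
count-remove {suc m} p {suc j} pj with p zero
... | true  = cong suc (count-remove (p ∘ suc) pj)
... | false = count-remove (p ∘ suc) pj

∖｛｝-self : (p : Fin m → Bool) (j : Fin m) → (p ∖｛ j ｝) j ≡ false
∖｛｝-self p j rewrite dec-true (j Fin.≟ j) refl = ∧-zeroʳ (p j)

count-≡⇒⊇ : p ⊆ q → count p ≡ count q → q ⊆ p
count-≡⇒⊇ {p = p} p⊆q c≡ i qi with p i in pi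
... | true  = refl
... | false = ⊥-elim (<-irrefl c≡ (count-mono-< p⊆q i qi pi))

count-∩｛｝ : (p : Fin m → Bool) (j : Fin m) → count (p ∩ ｛ j ｝) ≡ (if p j then 1 else 0)
count-∩｛｝ {suc m} p zero rewrite ∧-identityʳ (p zero) =
  trans (cong ((if p zero then 1 else 0) +_) (trans (count-cong λ i → ∧-zeroʳ (p (suc i))) (count-empty {m})))
        (+-identityʳ _)
count-∩｛｝ {suc m} p (suc j) rewrite ∧-zeroʳ (p zero) = count-∩｛｝ (p ∘ suc) j

count-｛｝ : (j : Fin m) → count ｛ j ｝ ≡ 1
count-｛｝ = count-∩｛｝ (λ _ → true)

⊆⇒false : p ⊆ q → ∀ {i} → q i ≡ false → p i ≡ false
⊆⇒false {p = p} p⊆q {i} qi with p i in pi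
... | true  = ⊥-elim (true⇒≢false (p⊆q i pi) qi)
... | false = refl

｛｝-self : (j : Fin m) → ｛ j ｝ j ≡ true
｛｝-self j = dec-true (j Fin.≟ j) refl

｛｝⇒≡ : {i j : Fin m} → ｛ j ｝ i ≡ true → i ≡ j
｛｝⇒≡ {i = i} {j} = does⇒ (i Fin.≟ j)

count≡1⇒≐｛｝ : (p : Fin m → Bool) {j : Fin m} → count p ≡ 1 → p j ≡ true → p ≐ ｛ j ｝
count≡1⇒≐｛｝ p {j} c≡1 pj = ⊆-antisym p⊆｛j｝ λ i ji → subst (λ x → p x ≡ true) (sym (｛｝⇒≡ ji)) pj
  where
  p⊆｛j｝ : p ⊆ ｛ j ｝
  p⊆｛j｝ i pi with i Fin.≟ j
  ... | yes _ = refl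
  ... | no i≢j = ⊥-elim (true⇒≢false (cong₂ _∧_ pi (cong not (dec-false (i Fin.≟ j) i≢j)))
                   (count-zero (p ∖｛ j ｝) (suc-injective (trans (sym (count-remove p pj)) c≡1)) i))

≢⇒<⊎> : ∀ {x y} → x ≢ y → x < y ⊎ y < x
≢⇒<⊎> {x} {y} x≢y with <-cmp x y
... | tri< x<y _ _ = inj₁ x<y
... | tri≈ _ x≡y _ = ⊥-elim (x≢y x≡y)
... | tri> _ _ y<x = inj₂ y<x

data Equality (p q : Fin m → Bool) : Set where
  equal   : p ≐ q → Equality p q
  differs : ∀ i → p i ≢ q i → Equality p q

equality? : (p q : Fin m → Bool) → Equality p q
equality? p q with inclusion? p q | inclusion? q p
... | included p⊆q    | included q⊆p    = equal (⊆-antisym p⊆q q⊆p)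
... | escapes i pi qi | _               = differs i λ pi≡qi → true⇒≢false pi (trans pi≡qi qi)
... | _               | escapes i qi pi = differs i λ pi≡qi → true⇒≢false qi (trans (sym pi≡qi) pi)

∩-congʳ : ∀ {r : Fin m → Bool} → q ≐ r → (p ∩ q) ≐ (p ∩ r)
∩-congʳ {p = p} q≐r i = cong (p i ∧_) (q≐r i)

∖｛｝-absent : (p : Fin m → Bool) {j : Fin m} → p j ≡ false → (p ∖｛ j ｝) ≐ p
∖｛｝-absent p {j} pj i with i Fin.≟ j
... | yes refl = trans (∧-zeroʳ (p i)) (sym pj)
... | no _ = ∧-identityʳ (p i)

∖｛｝-∩-comm : (p r : Fin m → Bool) (j : Fin m) → ((p ∖｛ j ｝) ∩ r) ≐ ((p ∩ r) ∖｛ j ｝)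
∖｛｝-∩-comm p r j i =
  trans (∧-assoc (p i) _ (r i)) (trans (cong (p i ∧_) (∧-comm _ (r i))) (sym (∧-assoc (p i) (r i) _)))

count-remove-∩ : (p r : Fin m → Bool) {j : Fin m} → p j ≡ true →
  count (p ∩ r) ≡ (if r j then 1 else 0) + count ((p ∖｛ j ｝) ∩ r)
count-remove-∩ p r {j} pj with r j in rj
... | true  = trans (count-remove (p ∩ r) (cong₂ _∧_ pj rj)) (cong suc (sym (count-cong (∖｛｝-∩-comm p r j))))
... | false = sym (trans (count-cong (∖｛｝-∩-comm p r j)) (count-cong (∖｛｝-absent (p ∩ r) p∩r-absent)))
  where
  p∩r-absent : (p ∩ r) j ≡ false
  p∩r-absent = trans (cong (p j ∧_) rj) (∧-zeroʳ (p j))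

∩-comm : (p q : Fin m → Bool) → (p ∩ q) ≐ (q ∩ p)
∩-comm p q i = ∧-comm (p i) (q i)

-- Forced wins in the Seurat game

Position : ℕ → Digraph → Set
Position c G = Fin c → Sub G

record Roles (c : ℕ) : Set where
  constructor roles
  field
    main spare : Fin c
    main≢spare : main ≢ spare

  spare≢main : spare ≢ main
  spare≢main = main≢spare ∘ sym

open Roles

swap : Roles c → Roles c
swap r = roles (spare r) (main r) (spare≢main r)

assign-same : (g : Fin c → A) (col : Fin c) (x : A) → assign g col x col ≡ x
assign-same g col x rewrite dec-true (col Fin.≟ col) refl = refl

assign-other : (g : Fin c → A) {col col′ : Fin c} (x : A) → col′ ≢ col → assign g col x col′ ≡ g col′
assign-other g {col} {col′} x col′≢col rewrite dec-false (col′ Fin.≟ col) col′≢col = refl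

count-assigned : (g : Fin c → Fin m → Bool) (col : Fin c) (S : Fin m → Bool) →
  count (assign g col S col) ≡ count S
count-assigned g col S = cong count (assign-same g col S)

ForallWins-swap : {g : Position c G} {h : Position c H} → ForallWins G H g h → ForallWins H G h g
ForallWins-swap (won (inj₁ (P , inj₁ (x , y))))     = won (inj₁ (P , inj₂ (y , x)))
ForallWins-swap (won (inj₁ (P , inj₂ (x , y))))     = won (inj₁ (P , inj₁ (y , x)))
ForallWins-swap (won (inj₂ (P , Q , inj₁ (x , y)))) = won (inj₂ (P , Q , inj₂ (y , x)))
ForallWins-swap (won (inj₂ (P , Q , inj₂ (x , y)))) = won (inj₂ (P , Q , inj₁ (y , x)))
ForallWins-swap (moveG col S k) = moveH col S (ForallWins-swap ∘ k)
ForallWins-swap (moveH col T k) = moveG col T (ForallWins-swap ∘ k)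

palette-unmatchedʳ : {g : Position c G} {h : Position c H} (a b : Fin c) (w : V H) →
  (∀ v → g a v ≡ h a w → g b v ≡ h b w → ⊥) → ForallWins G H g h
palette-unmatchedʳ {h = h} a b w unmatched =
  won (inj₁ ((λ col → h col w) , inj₂ ((λ (v , same) → unmatched v (same a) (same b)) , w , λ _ → refl)))

inclusion-violatedʳ : {g : Position c G} {h : Position c H} (a b : Fin c) → g b ⊆ g a →
  {u : V H} → h b u ≡ true → h a u ≡ false → ForallWins G H g h
inclusion-violatedʳ a b gb⊆ga {u} hbu hau = palette-unmatchedʳ a b u λ v ga gb →
  true⇒≢false (gb⊆ga v (trans gb hbu)) (trans ga hau)

inclusion-violatedˡ : {g : Position c G} {h : Position c H} (a b : Fin c) → h b ⊆ h a →
  {v : V G} → g b v ≡ true → g a v ≡ false → ForallWins G H g h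
inclusion-violatedˡ a b hb⊆ha gbv gav = ForallWins-swap (inclusion-violatedʳ a b hb⊆ha gbv gav)

-- ∀ paints the spare colour with h a minus one vertex w. Unless ∃ answers with a proper
-- subset of g a some palette is unmatched; if she does, the spare colour is now the smaller
-- one in G and the roles of the two colours swap.
size-mismatch< : ∀ {G H} fuel (r : Roles c) (g : Position c G) (h : Position c H) →
  count (g (main r)) < fuel → count (g (main r)) < count (h (main r)) → ForallWins G H g h
size-mismatch< {G = G} {H = H} (suc fuel) r g h g<fuel g<h = moveH b S respond
  where
  a = main r
  b = spare r
  chosen : ∃ λ w → h a w ≡ true
  chosen = count-pos⇒∃ (h a) (≤-trans (s≤s z≤n) g<h)
  w = proj₁ chosen
  haw = proj₂ chosen
  S = h a ∖｛ w ｝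
  respond : ∀ R → ForallWins G H (assign g b R) (assign h b S)
  respond R = by-cases (inclusion? R (g a)) (inclusion? (g a) R)
    where
    g′a = assign-other g R (main≢spare r)
    g′b = assign-same g b R
    h′a = assign-other h S (main≢spare r)
    h′b = assign-same h b S
    by-cases : Inclusion R (g a) → Inclusion (g a) R → ForallWins G H (assign g b R) (assign h b S)
    by-cases (escapes v Rv gav) _ =
      inclusion-violatedˡ a b (subst₂ _⊆_ (sym h′b) (sym h′a) (∩-⊆ˡ _ _))
        (trans (cong-app g′b v) Rv) (trans (cong-app g′a v) gav)
    by-cases (included _) (included ga⊆R) =
      inclusion-violatedʳ b a (subst₂ _⊆_ (sym g′a) (sym g′b) ga⊆R)
        (trans (cong-app h′a w) haw) (trans (cong-app h′b w) (∖｛｝-self (h a) w))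
    by-cases (included R⊆ga) (escapes v gav Rv) =
      size-mismatch< fuel (swap r) (assign g b R) (assign h b S)
        (subst (_< fuel) (sym (count-assigned g b R)) (<-≤-trans R<ga (≤-pred g<fuel)))
        (subst₂ _<_ (sym (count-assigned g b R)) (sym (count-assigned h b S))
          (<-≤-trans R<ga (≤-pred (subst (count (g a) <_) (count-remove (h a) haw) g<h))))
      where
      R<ga : count R < count (g a)
      R<ga = count-mono-< R⊆ga v gav Rv

size-mismatch : (r : Roles c) {g : Position c G} {h : Position c H} →
  count (g (main r)) ≢ count (h (main r)) → ForallWins G H g h
size-mismatch r {g} {h} ≢ with ≢⇒<⊎> ≢
... | inj₁ g<h = size-mismatch< _ r g h ≤-refl g<h
... | inj₂ h<g = ForallWins-swap (size-mismatch< _ r h g ≤-refl h<g)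

-- Tally classes

Tally : Set
Tally = ℕ × ℕ

-- tallies G k v = (t^v_{k-1} , … , t^v_0), so the paper's X^v_k is
-- tallyClass G (suc k) (tallies G (suc k) v).
tallies : (G : Digraph) (k : ℕ) → V G → Vec Tally k
tallies G zero    v = []
tallies G (suc k) v = prefix G k v

tallyClass : (G : Digraph) (k : ℕ) → Vec Tally k → Sub G
tallyClass G k s u = does (tallies G k u ≟P s)

tallies-suc : (G : Digraph) (k : ℕ) (v : V G) →
  tallies G (suc k) v ≡ τ G (tallyClass G k (tallies G k v)) v ∷ tallies G k v
tallies-suc G zero    v = refl
tallies-suc G (suc k) v = refl

∈-tallyClass : ∀ {k} (G : Digraph) {s : Vec Tally k} {u : V G} →
  tallies G k u ≡ s → tallyClass G k s u ≡ true
∈-tallyClass {k} G {s} {u} = dec-true (tallies G k u ≟P s)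

∉-tallyClass : ∀ {k} (G : Digraph) {s : Vec Tally k} {u : V G} →
  tallies G k u ≢ s → tallyClass G k s u ≡ false
∉-tallyClass {k} G {s} {u} = dec-false (tallies G k u ≟P s)

tallyClass⇒ : ∀ {k} (G : Digraph) {s : Vec Tally k} {u : V G} →
  tallyClass G k s u ≡ true → tallies G k u ≡ s
tallyClass⇒ {k} G {s} {u} = does⇒ (tallies G k u ≟P s)

tallies-suc-at : ∀ {k} (G : Digraph) {s : Vec Tally k} {v : V G} → tallies G k v ≡ s →
  tallies G (suc k) v ≡ τ G (tallyClass G k s) v ∷ s
tallies-suc-at G {v = v} refl = tallies-suc G _ v

tallyClass-suc⊆ : ∀ {k} (G : Digraph) (t : Tally) (s : Vec Tally k) →
  tallyClass G (suc k) (t ∷ s) ⊆ tallyClass G k s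
tallyClass-suc⊆ {k} G t s u u∈ =
  ∈-tallyClass G (proj₂ (∷-injective (trans (sym (tallies-suc G k u)) (tallyClass⇒ G u∈))))

ClassMustBeCopied : ℕ → Set
ClassMustBeCopied k = ∀ {c G H} (r : Roles c) (g : Position c G) (h : Position c H) (s : Vec Tally k) →
  g (main r) ≐ tallyClass G k s → (w : V H) → h (main r) w ≢ tallyClass H k s w → ForallWins G H g h

ClassCountMustAgree : ℕ → Set
ClassCountMustAgree k = ∀ {c G H} (r : Roles c) (g : Position c G) (h : Position c H) (s : Vec Tally k) →
  count (tallyClass G k s ∩ g (main r)) ≢ count (tallyClass H k s ∩ h (main r)) → ForallWins G H g h

-- ∀ paints the spare colour with X, then the main colour with the class; ∃'s answer Z
-- must stay inside h a and inside the class, hence it is smaller than X.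
copied⇒count-agrees> : ClassMustBeCopied k → ∀ {c G H} (r : Roles c) (g : Position c G) (h : Position c H)
  (s : Vec Tally k) → count (tallyClass H k s ∩ h (main r)) < count (tallyClass G k s ∩ g (main r)) →
  ForallWins G H g h
copied⇒count-agrees> {k} copied {G = G} {H} r g h s H<G = moveG b X respond
  where
  a = main r
  b = spare r
  X = tallyClass G k s ∩ g a
  g₁ = assign g b X
  g₁b⊆g₁a : g₁ b ⊆ g₁ a
  g₁b⊆g₁a = subst₂ _⊆_ (sym (assign-same g b X)) (sym (assign-other g X (main≢spare r))) (∩-⊆ʳ _ _)
  respond : ∀ Z → ForallWins G H g₁ (assign h b Z)
  respond Z with inclusion? Z (h a)
  ... | escapes u Zu hau = inclusion-violatedʳ a b g₁b⊆g₁a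
    (trans (cong-app (assign-same h b Z) u) Zu) (trans (cong-app (assign-other h Z (main≢spare r)) u) hau)
  ... | included Z⊆ha = moveG a (tallyClass G k s) respond′
    where
    C = tallyClass H k s
    h₁ = assign h b Z
    respond′ : ∀ T → ForallWins G H (assign g₁ a (tallyClass G k s)) (assign h₁ a T)
    respond′ T = by-cases (equality? T C) (inclusion? Z C)
      where
      g₂a = assign-same g₁ a (tallyClass G k s)
      h₂a = assign-same h₁ a T
      g₂b : assign g₁ a (tallyClass G k s) b ≡ X
      g₂b = trans (assign-other g₁ _ (spare≢main r)) (assign-same g b X)
      h₂b : assign h₁ a T b ≡ Z
      h₂b = trans (assign-other h₁ T (spare≢main r)) (assign-same h b Z)
      by-cases : Equality T C → Inclusion Z C →
        ForallWins G H (assign g₁ a (tallyClass G k s)) (assign h₁ a T)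
      by-cases (differs u Tu≢Cu) _ =
        copied r _ _ s (cong-app g₂a) u (Tu≢Cu ∘ trans (sym (cong-app h₂a u)))
      by-cases (equal T≐C) (escapes u Zu Cu) =
        inclusion-violatedʳ a b (subst₂ _⊆_ (sym g₂b) (sym g₂a) (∩-⊆ˡ _ _))
          (trans (cong-app h₂b u) Zu) (trans (cong-app h₂a u) (trans (T≐C u) Cu))
      by-cases (equal _) (included Z⊆C) =
        size-mismatch (swap r) λ eq →
          <⇒≢ Z<X (trans (sym (cong count h₂b)) (trans (sym eq) (cong count g₂b)))
        where
        Z<X : count Z < count X
        Z<X = ≤-<-trans (count-mono (⊆-∩ Z⊆C Z⊆ha)) H<G

copied⇒count-agrees : ClassMustBeCopied k → ClassCountMustAgree k
copied⇒count-agrees copied r g h s ≢ with ≢⇒<⊎> ≢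
... | inj₁ G<H = ForallWins-swap (copied⇒count-agrees> copied r h g s G<H)
... | inj₂ H<G = copied⇒count-agrees> copied r g h s H<G

data Direction : Set where
  incoming outgoing : Direction

neighbours : (G : Digraph) → Direction → V G → Sub G
neighbours G incoming z u = E G u z
neighbours G outgoing z u = E G z u

module _ {c} {G H : Digraph} (r : Roles c) where

  private
    a = main r
    b = spare r

  -- The edge between w and u has no counterpart in G, where z alone has the spare colour.
  neighbourhood-violated : (d : Direction) {g : Position c G} {h : Position c H} {z : V G} {w : V H} →
    g b ≐ ｛ z ｝ → h b ≐ ｛ w ｝ → neighbours G d z ⊆ g a →
    {u : V H} → neighbours H d w u ≡ true → h a u ≡ false → ForallWins G H g h
  neighbourhood-violated outgoing {g} {h} {z} {w} gb hb Nz⊆ga {u} wu hau =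
    won (inj₂ (_ , _ , inj₂ (no-edge , w , u , (λ _ → refl) , (λ _ → refl) , wu)))
    where
    no-edge : ¬ EdgePal G g (λ col → h col w) (λ col → h col u)
    no-edge (u′ , v′ , u′∼w , v′∼u , u′v′) =
      true⇒≢false (Nz⊆ga v′ (subst (λ x → E G x v′ ≡ true) u′≡z u′v′)) (trans (v′∼u a) hau)
      where
      u′≡z : u′ ≡ z
      u′≡z = ｛｝⇒≡ (trans (sym (gb u′)) (trans (u′∼w b) (trans (hb w) (｛｝-self w))))
  neighbourhood-violated incoming {g} {h} {z} {w} gb hb Nz⊆ga {u} uw hau =
    won (inj₂ (_ , _ , inj₂ (no-edge , u , w , (λ _ → refl) , (λ _ → refl) , uw)))
    where
    no-edge : ¬ EdgePal G g (λ col → h col u) (λ col → h col w)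
    no-edge (u′ , v′ , u′∼u , v′∼w , u′v′) =
      true⇒≢false (Nz⊆ga u′ (subst (λ x → E G u′ x ≡ true) v′≡z u′v′)) (trans (u′∼u a) hau)
      where
      v′≡z : v′ ≡ z
      v′≡z = ｛｝⇒≡ (trans (sym (gb v′)) (trans (v′∼w b) (trans (hb w) (｛｝-self w))))

  paint-neighbours : (d : Direction) {g : Position c G} {h : Position c H} {z : V G} {w : V H} →
    g b ≐ ｛ z ｝ → h b ≐ ｛ w ｝ →
    (∀ Q → neighbours H d w ⊆ Q → ForallWins G H (assign g a (neighbours G d z)) (assign h a Q)) →
    ForallWins G H g h
  paint-neighbours d {g} {h} {z} {w} gb hb continue =
    moveG a (neighbours G d z) λ Q → respond Q (inclusion? _ Q)
    where
    respond : ∀ Q → Inclusion (neighbours H d w) Q →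
      ForallWins G H (assign g a (neighbours G d z)) (assign h a Q)
    respond Q (included Nw⊆Q) = continue Q Nw⊆Q
    respond Q (escapes u Nwu Qu) =
      neighbourhood-violated d
        (λ v → trans (cong-app (assign-other g _ (spare≢main r)) v) (gb v))
        (λ v → trans (cong-app (assign-other h Q (spare≢main r)) v) (hb v))
        (λ v Nzv → trans (cong-app (assign-same g a _) v) Nzv)
        Nwu (trans (cong-app (assign-same h a Q) u) Qu)

degree-mismatch< : ∀ {c G H} (r : Roles c) (d : Direction) {g : Position c G} {h : Position c H}
  {z : V G} {w : V H} → g (spare r) ≐ ｛ z ｝ → h (spare r) ≐ ｛ w ｝ →
  count (neighbours G d z) < count (neighbours H d w) → ForallWins G H g h
degree-mismatch< r d {g} {h} gb hb z<w = paint-neighbours r d gb hb λ Q Nw⊆Q →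
  size-mismatch r (<⇒≢ (subst₂ _<_ (sym (count-assigned g (main r) _)) (sym (count-assigned h (main r) Q))
    (<-≤-trans z<w (count-mono Nw⊆Q))))

degree-mismatch : ∀ {c G H} (r : Roles c) (d : Direction) {g : Position c G} {h : Position c H}
  {z : V G} {w : V H} → g (spare r) ≐ ｛ z ｝ → h (spare r) ≐ ｛ w ｝ →
  count (neighbours G d z) ≢ count (neighbours H d w) → ForallWins G H g h
degree-mismatch r d gb hb ≢ with ≢⇒<⊎> ≢
... | inj₁ z<w = degree-mismatch< r d gb hb z<w
... | inj₂ w<z = ForallWins-swap (degree-mismatch< r d hb gb w<z)

module _ {k} (agree : ClassCountMustAgree k) where

  class-neighbours-mismatch : ∀ {c G H} (r : Roles c) (d : Direction) {g : Position c G} {h : Position c H}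
    {z : V G} {w : V H} → g (spare r) ≐ ｛ z ｝ → h (spare r) ≐ ｛ w ｝ → (s : Vec Tally k) →
    count (tallyClass G k s ∩ neighbours G d z) ≢ count (tallyClass H k s ∩ neighbours H d w) →
    ForallWins G H g h
  class-neighbours-mismatch {G = G} {H} r d {g} {h} {z} {w} gb hb s ≢
    with count (neighbours G d z) ≟ count (neighbours H d w)
  ... | no deg≢ = degree-mismatch r d gb hb deg≢
  ... | yes deg≡ = paint-neighbours r d gb hb λ Q Nw⊆Q → respond Q Nw⊆Q (count Q ≟ count (neighbours G d z))
    where
    respond : ∀ Q → neighbours H d w ⊆ Q → Dec (count Q ≡ count (neighbours G d z)) →
      ForallWins G H (assign g (main r) (neighbours G d z)) (assign h (main r) Q)
    respond Q Nw⊆Q (no Q≢) = size-mismatch r λ eq →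
      Q≢ (trans (sym (count-assigned h (main r) Q)) (trans (sym eq) (count-assigned g (main r) _)))
    respond Q Nw⊆Q (yes Q≡) = agree r g′ h′ s λ eq → ≢ (begin
      count (tallyClass G k s ∩ neighbours G d z)  ≡⟨ count-cong (∩-congʳ g′a) ⟨
      count (tallyClass G k s ∩ g′ (main r))       ≡⟨ eq ⟩
      count (tallyClass H k s ∩ h′ (main r))       ≡⟨ count-cong (∩-congʳ h′a) ⟩
      count (tallyClass H k s ∩ neighbours H d w)  ∎)
      where
      open ≡-Reasoning
      g′ = assign g (main r) (neighbours G d z)
      h′ = assign h (main r) Q
      g′a : g′ (main r) ≐ neighbours G d z
      g′a = cong-app (assign-same g (main r) (neighbours G d z))
      Q≐Nw : Q ≐ neighbours H d w
      Q≐Nw = ⊆-antisym (count-≡⇒⊇ Nw⊆Q (trans (sym deg≡) (sym Q≡))) Nw⊆Q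
      h′a : h′ (main r) ≐ neighbours H d w
      h′a v = trans (cong-app (assign-same h (main r) Q) v) (Q≐Nw v)

  tally-mismatch : ∀ {c G H} (r : Roles c) {g : Position c G} {h : Position c H} {z : V G} {w : V H} →
    g (spare r) ≐ ｛ z ｝ → h (spare r) ≐ ｛ w ｝ → (s : Vec Tally k) →
    τ G (tallyClass G k s) z ≢ τ H (tallyClass H k s) w → ForallWins G H g h
  tally-mismatch {G = G} {H} r {z = z} {w} gb hb s ≢
    with proj₁ (τ G (tallyClass G k s) z) ≟ proj₁ (τ H (tallyClass H k s) w)
  ... | no in≢ = class-neighbours-mismatch r incoming gb hb s in≢
  ... | yes in≡ with proj₂ (τ G (tallyClass G k s) z) ≟ proj₂ (τ H (tallyClass H k s) w)
  ...   | no out≢ = class-neighbours-mismatch r outgoing gb hb s out≢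
  ...   | yes out≡ = ⊥-elim (≢ (cong₂ _,_ in≡ out≡))

class-must-be-copied-zero : ClassMustBeCopied 0
class-must-be-copied-zero r g h [] ga≐ w mis =
  palette-unmatchedʳ (main r) (main r) w λ v ga≡ _ → mis (trans (sym ga≡) (ga≐ v))

-- ∃ must answer ｛ w ｝ by some ｛ z ｝, where z has the main colour of w and lies in the
-- level-k class s; then only their tallies relative to s can separate z from w.
pinned-vertex-must-match : ∀ {k} → ClassCountMustAgree k →
  ∀ {c G H} (r : Roles c) (g : Position c G) (h : Position c H) (t : Tally) (s : Vec Tally k) →
  g (main r) ≐ tallyClass G (suc k) (t ∷ s) → (w : V H) → tallies H k w ≡ s →
  h (main r) w ≢ tallyClass H (suc k) (t ∷ s) w → ForallWins G H g h
pinned-vertex-must-match {k} agree {G = G} {H} r g h t s ga≐ w w∈s mis = moveH b ｛ w ｝ respond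
  where
  a = main r
  b = spare r
  respond : ∀ Z → ForallWins G H (assign g b Z) (assign h b ｛ w ｝)
  respond Z with count Z ≟ 1
  ... | no Z≢1 = size-mismatch (swap r) λ eq → Z≢1 (begin
    count Z                         ≡⟨ count-assigned g b Z ⟨
    count (assign g b Z b)          ≡⟨ eq ⟩
    count (assign h b ｛ w ｝ b)    ≡⟨ count-assigned h b ｛ w ｝ ⟩
    count ｛ w ｝                   ≡⟨ count-｛｝ w ⟩
    1                               ∎)
    where open ≡-Reasoning
  ... | yes Z≡1 = let z , Zz = count-pos⇒∃ Z (subst (0 <_) (sym Z≡1) (s≤s z≤n)) in partner z Zz
    where
    g′ = assign g b Z
    h′ = assign h b ｛ w ｝
    g′a : g′ a ≡ g a
    g′a = assign-other g Z (main≢spare r)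
    h′a : h′ a ≡ h a
    h′a = assign-other h ｛ w ｝ (main≢spare r)
    h′b : h′ b ≐ ｛ w ｝
    h′b = cong-app (assign-same h b ｛ w ｝)
    partner : ∀ z → Z z ≡ true → ForallWins G H g′ h′
    partner z Zz = by-cases (g a z ≟ᵇ h a w) (tallies G k z ≟P s)
      where
      g′b : g′ b ≐ ｛ z ｝
      g′b v = trans (cong-app (assign-same g b Z) v) (count≡1⇒≐｛｝ Z Z≡1 Zz v)
      same-tallies : τ G (tallyClass G k s) z ≡ τ H (tallyClass H k s) w → tallies G k z ≡ s →
        tallies G (suc k) z ≡ tallies H (suc k) w
      same-tallies τ≡ z∈s = begin
        tallies G (suc k) z             ≡⟨ tallies-suc-at G z∈s ⟩
        τ G (tallyClass G k s) z ∷ s    ≡⟨ cong (_∷ s) τ≡ ⟩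
        τ H (tallyClass H k s) w ∷ s    ≡⟨ tallies-suc-at H w∈s ⟨
        tallies H (suc k) w             ∎
        where open ≡-Reasoning
      by-cases : Dec (g a z ≡ h a w) → Dec (tallies G k z ≡ s) → ForallWins G H g′ h′
      by-cases (no gaz≢haw) _ = palette-unmatchedʳ a b w λ v ga≡ gb≡ →
        let v≡z = ｛｝⇒≡ (trans (sym (g′b v)) (trans gb≡ (trans (h′b w) (｛｝-self w))))
        in gaz≢haw (subst (λ x → g a x ≡ h a w) v≡z (trans (sym (cong-app g′a v)) (trans ga≡ (cong-app h′a w))))
      by-cases (yes _) (no z∉s) = agree (swap r) g′ h′ s λ eq → 0≢1+n (trans (sym z-side) (trans eq w-side))
        where
        z-side : count (tallyClass G k s ∩ g′ b) ≡ 0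
        z-side = trans (count-cong (∩-congʳ g′b))
          (trans (count-∩｛｝ _ z) (cong (λ x → if x then 1 else 0) (∉-tallyClass G z∉s)))
        w-side : count (tallyClass H k s ∩ h′ b) ≡ 1
        w-side = trans (count-cong (∩-congʳ h′b))
          (trans (count-∩｛｝ _ w) (cong (λ x → if x then 1 else 0) (∈-tallyClass H w∈s)))
      by-cases (yes gaz≡haw) (yes z∈s) = tally-mismatch agree r g′b h′b s λ τ≡ →
        mis (trans (sym gaz≡haw) (trans (ga≐ z) (cong (λ x → does (x ≟P (t ∷ s))) (same-tallies τ≡ z∈s))))

-- Once ∃ has copied the level-k class s onto the spare colour, her main colour lies inside
-- it, and so does the vertex w where her copy fails.
class-must-be-copied-suc : ∀ {k} → ClassMustBeCopied k → ClassCountMustAgree k → ClassMustBeCopied (suc k)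
class-must-be-copied-suc {k} copied agree {G = G} {H} r g h (t ∷ s) ga≐ w mis =
  moveG b (tallyClass G k s) respond
  where
  a = main r
  b = spare r
  g₁ = assign g b (tallyClass G k s)
  g₁a : g₁ a ≡ g a
  g₁a = assign-other g _ (main≢spare r)
  g₁a⊆g₁b : g₁ a ⊆ g₁ b
  g₁a⊆g₁b v g₁av = trans (cong-app (assign-same g b _) v)
    (tallyClass-suc⊆ G t s v (trans (sym (ga≐ v)) (trans (sym (cong-app g₁a v)) g₁av)))
  respond : ∀ D → ForallWins G H g₁ (assign h b D)
  respond D = by-cases (equality? D (tallyClass H k s)) (inclusion? (h a) (tallyClass H k s))
    where
    h₁ = assign h b D
    h₁a : h₁ a ≡ h a
    h₁a = assign-other h D (main≢spare r)
    by-cases : Equality D (tallyClass H k s) → Inclusion (h a) (tallyClass H k s) → ForallWins G H g₁ h₁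
    by-cases (differs u Du≢) _ =
      copied (swap r) g₁ h₁ s (cong-app (assign-same g b _)) u
        (Du≢ ∘ trans (sym (cong-app (assign-same h b D) u)))
    by-cases (equal D≐) (escapes u hau u∉s) =
      inclusion-violatedʳ b a g₁a⊆g₁b (trans (cong-app h₁a u) hau)
        (trans (cong-app (assign-same h b D) u) (trans (D≐ u) u∉s))
    by-cases (equal _) (included ha⊆s) =
      pinned-vertex-must-match agree r g₁ h₁ t s (λ v → trans (cong-app g₁a v) (ga≐ v)) w w∈s
        (mis ∘ trans (sym (cong-app h₁a w)))
      where
      w∈s : tallies H k w ≡ s
      w∈s with tallies H k w ≟P s
      ... | yes w∈s = w∈s
      ... | no w∉s = ⊥-elim (mis (trans (⊆⇒false ha⊆s (∉-tallyClass H w∉s))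
                                        (sym (⊆⇒false (tallyClass-suc⊆ H t s) (∉-tallyClass H w∉s)))))

class-must-be-copied : ∀ k → ClassMustBeCopied k
class-count-must-agree : ∀ k → ClassCountMustAgree k

class-must-be-copied zero = class-must-be-copied-zero
class-must-be-copied (suc k) = class-must-be-copied-suc (class-must-be-copied k) (class-count-must-agree k)

class-count-must-agree k = copied⇒count-agrees (class-must-be-copied k)

-- Stabilisation of the tally refinement

StableAt : Digraph → ℕ → Set
StableAt G j = ∀ u v → tallies G j u ≡ tallies G j v → tallies G (suc j) u ≡ tallies G (suc j) v

tallies-tail : ∀ {k} (G H : Digraph) {v : V G} {w : V H} →
  tallies G (suc k) v ≡ tallies H (suc k) w → tallies G k v ≡ tallies H k w
tallies-tail {k} G H {v} {w} eq =
  proj₂ (∷-injective (trans (sym (tallies-suc G k v)) (trans eq (tallies-suc H k w))))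

tallySeq≡τ : (G : Digraph) (k : ℕ) (v : V G) → tallySeq G v k ≡ τ G (tallyClass G k (tallies G k v)) v
tallySeq≡τ G k v = cong head (tallies-suc G k v)

τ-cong : (G : Digraph) {Y Y′ : Sub G} → Y ≐ Y′ → ∀ v → τ G Y v ≡ τ G Y′ v
τ-cong G {Y} {Y′} Y≐Y′ v =
  cong₂ _,_ (count-cong λ u → cong (_∧ E G u v) (Y≐Y′ u)) (count-cong λ u → cong (_∧ E G v u) (Y≐Y′ u))

module _ {G : Digraph} {j : ℕ} (stable : StableAt G j) where

  stable-classes : ∀ v → tallyClass G (suc j) (tallies G (suc j) v) ≐ tallyClass G j (tallies G j v)
  stable-classes v u = does-⇔ (mk⇔ (tallies-tail G G) (stable u v))
    (tallies G (suc j) u ≟P tallies G (suc j) v) (tallies G j u ≟P tallies G j v)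

  stable-tallySeq : ∀ v → tallySeq G v (suc j) ≡ tallySeq G v j
  stable-tallySeq v = trans (τ-cong G (stable-classes v) v) (sym (tallySeq≡τ G j v))

  stable-suc : StableAt G (suc j)
  stable-suc u v eq =
    cong₂ _∷_ (trans (stable-tallySeq u) (trans (cong head eq) (sym (stable-tallySeq v)))) eq

tallySeq-constant : ∀ {G j k} → StableAt G j → j ≤′ k →
  StableAt G k × (∀ v → tallySeq G v k ≡ tallySeq G v j)
tallySeq-constant stable ≤′-refl = stable , λ _ → refl
tallySeq-constant stable (≤′-step j≤k) =
  let stable′ , const = tallySeq-constant stable j≤k
  in stable-suc stable′ , λ v → trans (stable-tallySeq stable′ v) (const v)

-- Pairs (u , v) are coded as combine u v, so the number of pairs with equal tallies is a
-- count; it drops at every step where the refinement is not yet stable.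
sameTallies : (G : Digraph) (k : ℕ) → Fin (n G * n G) → Bool
sameTallies G k i = uncurry (λ u v → tallyClass G k (tallies G k v) u) (remQuot (n G) i)

sameTallies-combine : (G : Digraph) (k : ℕ) (u v : V G) →
  sameTallies G k (combine u v) ≡ tallyClass G k (tallies G k v) u
sameTallies-combine G k u v = cong (uncurry λ u v → tallyClass G k (tallies G k v) u) (remQuot-combine u v)

sameTallies-suc⊆ : (G : Digraph) (k : ℕ) → sameTallies G (suc k) ⊆ sameTallies G k
sameTallies-suc⊆ G k i with remQuot {n G} (n G) i
... | u , v = ∈-tallyClass {k} G ∘ tallies-tail G G ∘ tallyClass⇒ {suc k} G

sameTallies⇒StableAt : (G : Digraph) (j : ℕ) → sameTallies G j ⊆ sameTallies G (suc j) → StableAt G j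
sameTallies⇒StableAt G j ⊆suc u v eq = tallyClass⇒ {suc j} G (begin
  tallyClass G (suc j) (tallies G (suc j) v) u ≡⟨ sameTallies-combine G (suc j) u v ⟨
  sameTallies G (suc j) (combine u v)
    ≡⟨ ⊆suc (combine u v) (trans (sameTallies-combine G j u v) (∈-tallyClass {j} G eq)) ⟩
  true                                         ∎)
  where open ≡-Reasoning

stabilises-within : (G : Digraph) (k : ℕ) →
  (∃ λ j → j < k × StableAt G j) ⊎ (k + count (sameTallies G k) ≤ n G * n G)
stabilises-within G zero = inj₂ (count-≤ (sameTallies G 0))
stabilises-within G (suc k) with stabilises-within G k | inclusion? (sameTallies G k) (sameTallies G (suc k))
... | inj₁ (j , j<k , stable) | _ = inj₁ (j , m<n⇒m<1+n j<k , stable)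
... | inj₂ _ | included ⊆suc = inj₁ (k , n<1+n k , sameTallies⇒StableAt G k ⊆suc)
... | inj₂ bound | escapes i ∈k ∉suc = inj₂ (begin
  suc k + count (sameTallies G (suc k))  ≡⟨ +-suc k _ ⟨
  k + suc (count (sameTallies G (suc k))) ≤⟨ +-monoʳ-≤ k (count-mono-< (sameTallies-suc⊆ G k) i ∈k ∉suc) ⟩
  k + count (sameTallies G k)            ≤⟨ bound ⟩
  n G * n G                              ∎)
  where open ≤-Reasoning

stable-index : (G : Digraph) → ∃ λ j → j ≤ n G * n G × StableAt G j
stable-index G with stabilises-within G (suc (n G * n G))
... | inj₁ (j , j<suc , stable) = j , ≤-pred j<suc , stable
... | inj₂ bound = ⊥-elim (1+n≰n (m+n≤o⇒m≤o (suc (n G * n G)) bound))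

tallies-≤′ : ∀ {k K} (G H : Digraph) {v : V G} {w : V H} → k ≤′ K →
  tallies G K v ≡ tallies H K w → tallies G k v ≡ tallies H k w
tallies-≤′ G H ≤′-refl = id
tallies-≤′ G H (≤′-step k≤K) = tallies-≤′ G H k≤K ∘ tallies-tail G H

tallies-determine-tallySeq : ∀ {K} (G H : Digraph) →
  (∃ λ j → j ≤ K × StableAt G j) → (∃ λ j → j ≤ K × StableAt H j) →
  ∀ {v w} → tallies G (suc K) v ≡ tallies H (suc K) w → ∀ k → tallySeq G v k ≡ tallySeq H w k
tallies-determine-tallySeq {K} G H (jG , jG≤K , stableG) (jH , jH≤K , stableH) {v} {w} eq = agree
  where
  agree-≤ : ∀ {k} → k ≤ K → tallySeq G v k ≡ tallySeq H w k
  agree-≤ k≤K = cong head (tallies-≤′ G H (≤⇒≤′ (s≤s k≤K)) eq)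
  constant : ∀ {D j} → StableAt D j → j ≤ K → ∀ {k} → K ≤ k → ∀ u → tallySeq D u k ≡ tallySeq D u K
  constant stable j≤K K≤k u =
    trans (proj₂ (tallySeq-constant stable (≤⇒≤′ (≤-trans j≤K K≤k))) u)
          (sym (proj₂ (tallySeq-constant stable (≤⇒≤′ j≤K)) u))
  agree : ∀ k → tallySeq G v k ≡ tallySeq H w k
  agree k with k ≤? K
  ... | yes k≤K = agree-≤ k≤K
  ... | no k≰K = begin
    tallySeq G v k ≡⟨ constant stableG jG≤K K≤k v ⟩
    tallySeq G v K ≡⟨ agree-≤ ≤-refl ⟩
    tallySeq H w K ≡⟨ constant stableH jH≤K K≤k w ⟨
    tallySeq H w k ∎
    where
    open ≡-Reasoning
    K≤k = <⇒≤ (≰⇒> k≰K)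

-- Bijections from equal fibre counts

Members : (Fin m → Bool) → Set
Members {m} p = Σ (Fin m) λ i → p i ≡ true

Members-≡ : {p : Fin m → Bool} {a b : Members p} → proj₁ a ≡ proj₁ b → a ≡ b
Members-≡ {a = i , x} {b = .i , y} refl = cong (i ,_) (Decidable⇒UIP.≡-irrelevant _≟ᵇ_ x y)

split-at : (p : Fin m → Bool) {i : Fin m} → p i ≡ true → Members p ↔ (⊤ ⊎ Members (p ∖｛ i ｝))
split-at p {i} pi = mk↔ₛ′ to from to∘from from∘to
  where
  to′ : ∀ j → p j ≡ true → Dec (j ≡ i) → ⊤ ⊎ Members (p ∖｛ i ｝)
  to′ j pj (yes _)  = inj₁ tt
  to′ j pj (no j≢i) = inj₂ (j , cong₂ _∧_ pj (cong not (dec-false (j Fin.≟ i) j≢i)))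
  to : Members p → ⊤ ⊎ Members (p ∖｛ i ｝)
  to (j , pj) = to′ j pj (j Fin.≟ i)
  from : ⊤ ⊎ Members (p ∖｛ i ｝) → Members p
  from (inj₁ _) = i , pi
  from (inj₂ (j , p′j)) = j , ∩-⊆ˡ p (not ∘ ｛ i ｝) j p′j
  to∘from : ∀ x → to (from x) ≡ x
  to∘from (inj₁ _) with i Fin.≟ i
  ... | yes _ = refl
  ... | no i≢i = ⊥-elim (i≢i refl)
  to∘from (inj₂ (j , p′j)) = to-other (j Fin.≟ i)
    where
    to-other : (j≟i : Dec (j ≡ i)) → to′ j (∩-⊆ˡ p (not ∘ ｛ i ｝) j p′j) j≟i ≡ inj₂ (j , p′j)
    to-other (no _) = cong inj₂ (Members-≡ refl)
    to-other (yes j≡i) = ⊥-elim (true⇒≢false p′j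
      (trans (cong (λ x → p j ∧ not x) (dec-true (j Fin.≟ i) j≡i)) (∧-zeroʳ (p j))))
  from∘to : ∀ a → from (to a) ≡ a
  from∘to (j , pj) with j Fin.≟ i
  ... | yes j≡i = Members-≡ (sym j≡i)
  ... | no _ = Members-≡ refl

module _ {K : Set} (_≟K_ : DecidableEquality K) where

  fibre : (Fin m → K) → K → Fin m → Bool
  fibre f κ i = does (f i ≟K κ)

  LabelledBijection : (p : Fin m → Bool) (q : Fin m′ → Bool) → (Fin m → K) → (Fin m′ → K) → Set
  LabelledBijection p q f g =
    Σ (Members p ↔ Members q) λ φ → ∀ a → f (proj₁ a) ≡ g (proj₁ (Inverse.to φ a))

  extend : {p : Fin m → Bool} {q : Fin m′ → Bool} {f : Fin m → K} {g : Fin m′ → K} {i : Fin m} {j : Fin m′} →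
    p i ≡ true → q j ≡ true → f i ≡ g j →
    LabelledBijection (p ∖｛ i ｝) (q ∖｛ j ｝) f g → LabelledBijection p q f g
  extend {p = p} {q} {f} {g} {i} {j} pi qj fi≡gj (φ , preserves) = φ′ , preserves′
    where
    φ′ : Members p ↔ Members q
    φ′ = ↔-trans (split-at p pi) (↔-trans (↔-refl ⊎-↔ φ) (↔-sym (split-at q qj)))
    preserves′ : ∀ a → f (proj₁ a) ≡ g (proj₁ (Inverse.to φ′ a))
    preserves′ (k , pk) with k Fin.≟ i
    ... | yes refl = fi≡gj
    ... | no _ = preserves (k , _)

  equal-fibres⇒bijection : ∀ c (p : Fin m → Bool) (q : Fin m′ → Bool) (f : Fin m → K) (g : Fin m′ → K) →
    count p ≡ c → (∀ κ → count (p ∩ fibre f κ) ≡ count (q ∩ fibre g κ)) → LabelledBijection p q f g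
  equal-fibres⇒bijection zero p q f g p≡0 fibres =
    mk↔ₛ′ (⊥-elim ∘ no-p) (⊥-elim ∘ no-q) (⊥-elim ∘ no-q) (⊥-elim ∘ no-p) , ⊥-elim ∘ no-p
    where
    no-p : ¬ Members p
    no-p (i , pi) = true⇒≢false pi (count-zero p p≡0 i)
    no-q : ¬ Members q
    no-q (j , qj) = <⇒≱ (count-pos (q ∩ fibre g (g j)) (cong₂ _∧_ qj (dec-true (g j ≟K g j) refl))) (begin
      count (q ∩ fibre g (g j)) ≡⟨ fibres (g j) ⟨
      count (p ∩ fibre f (g j)) ≤⟨ count-mono (∩-⊆ˡ p (fibre f (g j))) ⟩
      count p                   ≡⟨ p≡0 ⟩
      0                         ∎)
      where open ≤-Reasoning
  equal-fibres⇒bijection (suc c) p q f g p≡1+c fibres = extend {p = p} {q} {f} {g} pi qj (sym gj≡fi) rest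
    where
    first : Members p
    first = count-pos⇒∃ p (subst (0 <_) (sym p≡1+c) (s≤s z≤n))
    i = proj₁ first
    pi = proj₂ first
    partner : Members (q ∩ fibre g (f i))
    partner = count-pos⇒∃ (q ∩ fibre g (f i)) (subst (0 <_) (fibres (f i))
      (count-pos (p ∩ fibre f (f i)) (cong₂ _∧_ pi (dec-true (f i ≟K f i) refl))))
    j = proj₁ partner
    qj = ∩-⊆ˡ q (fibre g (f i)) j (proj₂ partner)
    gj≡fi : g j ≡ f i
    gj≡fi = does⇒ (g j ≟K f i) (∩-⊆ʳ q (fibre g (f i)) j (proj₂ partner))
    rest = equal-fibres⇒bijection c (p ∖｛ i ｝) (q ∖｛ j ｝) f g
      (suc-injective (trans (sym (count-remove p pi)) p≡1+c))
      λ κ → +-cancelˡ-≡ _ _ _ (begin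
        (if fibre f κ i then 1 else 0) + count ((p ∖｛ i ｝) ∩ fibre f κ)
          ≡⟨ count-remove-∩ p (fibre f κ) pi ⟨
        count (p ∩ fibre f κ)
          ≡⟨ fibres κ ⟩
        count (q ∩ fibre g κ)
          ≡⟨ count-remove-∩ q (fibre g κ) qj ⟩
        (if fibre g κ j then 1 else 0) + count ((q ∖｛ j ｝) ∩ fibre g κ)
          ≡⟨ cong (λ x → (if does (x ≟K κ) then 1 else 0) + count ((q ∖｛ j ｝) ∩ fibre g κ)) gj≡fi ⟩
        (if fibre f κ i then 1 else 0) + count ((q ∖｛ j ｝) ∩ fibre g κ) ∎)
      where open ≡-Reasoning

module _ (G H : Digraph) (X : Sub G) (Y : Sub H) where

  private
    K L : ℕ
    -- stable-index bounds the stabilisation step of each graph by its number of vertex pairs.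
    K = n G * n G + n H * n H
    L = suc K

  ClassCountsAgree : Vec Tally L → Set
  ClassCountsAgree s = count (tallyClass G L s ∩ X) ≡ count (tallyClass H L s ∩ Y)

  class-counts-agree? : ∀ s → Dec (ClassCountsAgree s)
  class-counts-agree? s = count (tallyClass G L s ∩ X) ≟ count (tallyClass H L s ∩ Y)

  class-counts-agree⇒same-spectrum : (∀ s → ClassCountsAgree s) → SameSpectrum G X H Y
  class-counts-agree⇒same-spectrum agree =
    proj₁ bijection , λ a → tallies-determine-tallySeq G H stableG stableH (proj₂ bijection a)
    where
    bijection = equal-fibres⇒bijection _≟P_ _ X Y (tallies G L) (tallies H L) refl λ s →
      trans (count-cong (∩-comm X _)) (trans (agree s) (count-cong (∩-comm _ Y)))
    stableG : ∃ λ j → j ≤ K × StableAt G j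
    stableG = let j , j≤ , st = stable-index G in j , ≤-trans j≤ (m≤m+n _ _) , st
    stableH : ∃ λ j → j ≤ K × StableAt H j
    stableH = let j , j≤ , st = stable-index H in j , ≤-trans j≤ (m≤n+m _ _) , st

  different-spectra⇒class-count-differs : ¬ SameSpectrum G X H Y → ∃ λ s → ¬ ClassCountsAgree s
  different-spectra⇒class-count-differs different
    with any? (λ v → ¬? (class-counts-agree? (tallies G L v)))
       | any? (λ w → ¬? (class-counts-agree? (tallies H L w)))
  ... | yes (v , ≢) | _ = tallies G L v , ≢
  ... | no _ | yes (w , ≢) = tallies H L w , ≢
  ... | no agreeG | no agreeH = ⊥-elim (different (class-counts-agree⇒same-spectrum agree))
    where
    unrealised : (D : Digraph) (Z : Sub D) (s : Vec Tally L) → ¬ (∃ λ v → tallies D L v ≡ s) →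
      count (tallyClass D L s ∩ Z) ≡ 0
    unrealised D Z s ∉ =
      trans (count-cong λ v → cong (_∧ Z v) (dec-false (tallies D L v ≟P s) (∉ ∘ (v ,_)))) (count-empty {n D})
    agree : ∀ s → ClassCountsAgree s
    agree s with any? (λ v → tallies G L v ≟P s) | any? (λ w → tallies H L w ≟P s)
    ... | yes (v , refl) | _ = decidable-stable (class-counts-agree? s) (agreeG ∘ (v ,_))
    ... | no _ | yes (w , refl) = decidable-stable (class-counts-agree? s) (agreeH ∘ (w ,_))
    ... | no ∉G | no ∉H = trans (unrealised G X s ∉G) (sym (unrealised H Y s ∉H))

corollary4p5 : (G H : Digraph) (X : Sub G) (Y : Sub H) →
    ¬ SameSpectrum G X H Y →
    ForallWins {2} G H (redOnly G X) (redOnly H Y)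
corollary4p5 G H X Y different =
  let s , counts≢ = different-spectra⇒class-count-differs G H X Y different
  in class-count-must-agree _ (roles zero (suc zero) λ ()) (redOnly G X) (redOnly H Y) s counts≢
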